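{- Let $k$ be a natural number and suppose $\varphi \rhd^* \psi$. (1) If $\psi \in \mathrm{E}_k^+$, then $\varphi \in \mathrm{E}_k^+$. (2) If $\psi \in \mathrm{U}_k^+$, then $\varphi \in \mathrm{U}_k^+$.
   Context: Fix an arbitrary first-order language whose logical symbols are $\forall, \exists, \to, \land, \lor, \perp$; $\mathrm{FV}(\varphi)$ is the set of free variables of $\varphi$. Alternation paths: finite sequences of $+$ and $-$ in which $+$ and $-$ alternate. For such $s$, $i(s)$ is its first symbol if $s$ is nonempty and a special symbol $\times$ if $s=\langle\,\rangle$; $s^\perp$ swaps $+$ and $-$; $l(s)$ is its length; $+s$, $-s$ denote prepending. $\mathrm{Alt}(\varphi)$: if $\varphi$ is quantifier-free, $\{\langle\,\rangle\}$; otherwise $\mathrm{Alt}(\varphi_1 \land \varphi_2)=\mathrm{Alt}(\varphi_1 \lor \varphi_2) = \mathrm{Alt}(\varphi_1)\cup\mathrm{Alt}(\varphi_2)$; $\mathrm{Alt}(\varphi_1\to\varphi_2) = \{s^\perp : s\in\mathrm{Alt}(\varphi_1)\}\cup\mathrm{Alt}(\varphi_2)$; $\mathrm{Alt}(\forall x\varphi_1) = \{s\in\mathrm{Alt}(\varphi_1): i(s)=-\}\cup\{ -s: s\in\mathrm{Alt}(\varphi_1), i(s)\neq -\}$; $\mathrm{Alt}(\exists x\varphi_1) = \{s\in\mathrm{Alt}(\varphi_1): i(s)=+\}\cup\{+s: s\in\mathrm{Alt}(\varphi_1), i(s)\neq +\}$. $\deg(\varphi)=\max\{l(s): s\in\mathrm{Alt}(\varphi)\}$.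 Classes: $\mathrm{F}_k=\{\varphi:\deg(\varphi)=k\}$; $\mathrm{U}_0=\mathrm{E}_0=\mathrm{F}_0$; $\mathrm{U}_{k+1}=\{\varphi\in\mathrm{F}_{k+1}: i(s)=- \text{ for all } s\in\mathrm{Alt}(\varphi) \text{ with } l(s)=k+1\}$; $\mathrm{E}_{k+1}$ likewise with $+$; $\mathrm{U}_k^+=\mathrm{U}_k\cup\bigcup_{i<k}\mathrm{F}_i$; $\mathrm{E}_k^+=\mathrm{E}_k\cup\bigcup_{i<k}\mathrm{F}_i$. Prenex transformation: $\varphi\rhd\psi$ means that for some formulas $\xi,\delta$, a variable $x\notin\mathrm{FV}(\delta)$, a variable $y$ not occurring in $\xi$, and $Q\in\{\forall,\exists\}$, $(\varphi,\psi)$ is one of: $(\exists x\xi(x)\to\delta, \forall x(\xi(x)\to\delta))$; $(\forall x\xi(x)\to\delta, \exists x(\xi(x)\to\delta))$; $(\delta\to Qx\,\xi(x), Qx(\delta\to\xi(x)))$; $(Qx\,\xi(x)\land\delta, Qx(\xi(x)\land\delta))$; $(\delta\land Qx\,\xi(x), Qx(\delta\land\xi(x)))$; $(Qx\,\xi(x)\lor\delta, Qx(\xi(x)\lor\delta))$; $(\delta\lor Qx\,\xi(x), Qx(\delta\lor\xi(x)))$; $(Qx\,\xi(x), Qy\,\xi(y))$, with $\xi(y)$ the substitution of $y$ for free $x$. $\varphi\rhd^*\psi$ means there are $m\ge0$ and $\varphi_0\equiv\varphi,\dots,\varphi_m\equiv\psi$ with each $\varphi_{i+1}$ obtained from $\varphi_i$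 by replacing one occurrence of a subformula $\xi_i$ with $\delta_i$ where $\xi_i\rhd\delta_i$. -}

module Defs where

open import Data.Nat using (ℕ; zero; suc; _<_; _⊔_; _≡ᵇ_)
open import Data.Bool using (Bool; true; false; if_then_else_; _∧_; not)
open import Data.List using (List; []; _∷_; _++_; map; filterᵇ; foldr; length)
open import Data.List.Membership.Propositional using (_∈_; _∉_)
open import Data.Maybe using (Maybe; just; nothing)
open import Data.Vec using (Vec; []; _∷_)
open import Data.Product using (_×_)
open import Data.Sum using (_⊎_)
open import Relation.Binary.PropositionalEquality using (_≡_)
open import Relation.Binary.Construct.Closure.ReflexiveTransitive using (Star)

record Signature : Set₁ where
  field
    Fun      : Set
    funArity : Fun → ℕ
    Rel      : Set
    relArity : Rel → ℕ

Var : Set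
Var = ℕ

module _ (L : Signature) where
  open Signature L

  data Term : Set where
    var : Var → Term
    fun : (f : Fun) → Vec Term (funArity f) → Term

  data Formula : Set where
    atom : (R : Rel) → Vec Term (relArity R) → Formula
    ⊥'   : Formula
    _⇒_  : Formula → Formula → Formula
    _∧'_ : Formula → Formula → Formula
    _∨'_ : Formula → Formula → Formula
    ∀'   : Var → Formula → Formula
    ∃'   : Var → Formula → Formula

module _ {L : Signature} where
  open Signature L

  mutual
    varsT : Term L → List Var
    varsT (var x) = x ∷ []
    varsT (fun f ts) = varsTs ts

    varsTs : ∀ {n} → Vec (Term L) n → List Var
    varsTs [] = []
    varsTs (t ∷ ts) = varsT t ++ varsTs ts

  FV : Formula L → List Var
  FV (atom R ts) = varsTs ts
  FV ⊥' = []
  FV (φ ⇒ ψ) = FV φ ++ FV ψ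
  FV (φ ∧' ψ) = FV φ ++ FV ψ
  FV (φ ∨' ψ) = FV φ ++ FV ψ
  FV (∀' x φ) = filterᵇ (λ v → not (v ≡ᵇ x)) (FV φ)
  FV (∃' x φ) = filterᵇ (λ v → not (v ≡ᵇ x)) (FV φ)

  occ : Formula L → List Var
  occ (atom R ts) = varsTs ts
  occ ⊥' = []
  occ (φ ⇒ ψ) = occ φ ++ occ ψ
  occ (φ ∧' ψ) = occ φ ++ occ ψ
  occ (φ ∨' ψ) = occ φ ++ occ ψ
  occ (∀' x φ) = x ∷ occ φ
  occ (∃' x φ) = x ∷ occ φ

  -- substitution of the variable y for the free occurrences of x
  -- (used only when y does not occur in the formula, so no capture arises)
  mutual
    substT : Var → Var → Term L → Term L
    substT x y (var z) = if z ≡ᵇ x then var y else var z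
    substT x y (fun f ts) = fun f (substTs x y ts)

    substTs : ∀ {n} → Var → Var → Vec (Term L) n → Vec (Term L) n
    substTs x y [] = []
    substTs x y (t ∷ ts) = substT x y t ∷ substTs x y ts

  subst : Var → Var → Formula L → Formula L
  subst x y (atom R ts) = atom R (substTs x y ts)
  subst x y ⊥' = ⊥'
  subst x y (φ ⇒ ψ) = subst x y φ ⇒ subst x y ψ
  subst x y (φ ∧' ψ) = subst x y φ ∧' subst x y ψ
  subst x y (φ ∨' ψ) = subst x y φ ∨' subst x y ψ
  subst x y (∀' z φ) = if z ≡ᵇ x then ∀' z φ else ∀' z (subst x y φ)
  subst x y (∃' z φ) = if z ≡ᵇ x then ∃' z φ else ∃' z (subst x y φ)

  qf : Formula L → Bool
  qf (atom R ts) = true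
  qf ⊥' = true
  qf (φ ⇒ ψ) = qf φ ∧ qf ψ
  qf (φ ∧' ψ) = qf φ ∧ qf ψ
  qf (φ ∨' ψ) = qf φ ∧ qf ψ
  qf (∀' x φ) = false
  qf (∃' x φ) = false

-- Alternation paths (lists of signs; a set of paths is a list)

data Sign : Set where
  plus minus : Sign

Path : Set
Path = List Sign

-- i(s): first symbol, nothing plays the role of ×
i : Path → Maybe Sign
i [] = nothing
i (a ∷ _) = just a

flip : Sign → Sign
flip plus = minus
flip minus = plus

_⊥ₚ : Path → Path
s ⊥ₚ = map flip s

isSign : Sign → Maybe Sign → Bool
isSign plus (just plus) = true
isSign minus (just minus) = true
isSign _ _ = false

module _ {L : Signature} where

  Alt : Formula L → List Path
  Alt (atom R ts) = [] ∷ []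
  Alt ⊥' = [] ∷ []
  Alt (φ ⇒ ψ) = if qf (φ ⇒ ψ) then [] ∷ [] else map _⊥ₚ (Alt φ) ++ Alt ψ
  Alt (φ ∧' ψ) = if qf (φ ∧' ψ) then [] ∷ [] else Alt φ ++ Alt ψ
  Alt (φ ∨' ψ) = if qf (φ ∨' ψ) then [] ∷ [] else Alt φ ++ Alt ψ
  Alt (∀' x φ) =
    filterᵇ (λ s → isSign minus (i s)) (Alt φ)
    ++ map (minus ∷_) (filterᵇ (λ s → not (isSign minus (i s))) (Alt φ))
  Alt (∃' x φ) =
    filterᵇ (λ s → isSign plus (i s)) (Alt φ)
    ++ map (plus ∷_) (filterᵇ (λ s → not (isSign plus (i s))) (Alt φ))

  deg : Formula L → ℕ
  deg φ = foldr _⊔_ 0 (map length (Alt φ))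

  F : ℕ → Formula L → Set
  F k φ = deg φ ≡ k

  U : ℕ → Formula L → Set
  U zero φ = F zero φ
  U (suc k) φ = F (suc k) φ × (∀ s → s ∈ Alt φ → length s ≡ suc k → i s ≡ just minus)

  E : ℕ → Formula L → Set
  E zero φ = F zero φ
  E (suc k) φ = F (suc k) φ × (∀ s → s ∈ Alt φ → length s ≡ suc k → i s ≡ just plus)

  U⁺ : ℕ → Formula L → Set
  U⁺ k φ = U k φ ⊎ deg φ < k

  E⁺ : ℕ → Formula L → Set
  E⁺ k φ = E k φ ⊎ deg φ < k

  data Quant : Set where
    ∀Q ∃Q : Quant

  Q[_] : Quant → Var → Formula L → Formula L
  Q[ ∀Q ] = ∀'
  Q[ ∃Q ] = ∃'

  data _▷_ : Formula L → Formula L → Set where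
    ∃⇒ : ∀ {x ξ δ} → x ∉ FV δ → (∃' x ξ ⇒ δ) ▷ ∀' x (ξ ⇒ δ)
    ∀⇒ : ∀ {x ξ δ} → x ∉ FV δ → (∀' x ξ ⇒ δ) ▷ ∃' x (ξ ⇒ δ)
    ⇒Q : ∀ {Q x ξ δ} → x ∉ FV δ → (δ ⇒ Q[ Q ] x ξ) ▷ Q[ Q ] x (δ ⇒ ξ)
    Q∧ : ∀ {Q x ξ δ} → x ∉ FV δ → (Q[ Q ] x ξ ∧' δ) ▷ Q[ Q ] x (ξ ∧' δ)
    ∧Q : ∀ {Q x ξ δ} → x ∉ FV δ → (δ ∧' Q[ Q ] x ξ) ▷ Q[ Q ] x (δ ∧' ξ)
    Q∨ : ∀ {Q x ξ δ} → x ∉ FV δ → (Q[ Q ] x ξ ∨' δ) ▷ Q[ Q ] x (ξ ∨' δ)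
    ∨Q : ∀ {Q x ξ δ} → x ∉ FV δ → (δ ∨' Q[ Q ] x ξ) ▷ Q[ Q ] x (δ ∨' ξ)
    ren : ∀ {Q x y ξ} → y ∉ occ ξ → Q[ Q ] x ξ ▷ Q[ Q ] y (subst x y ξ)

  data _▷₁_ : Formula L → Formula L → Set where
    here : ∀ {φ ψ} → φ ▷ ψ → φ ▷₁ ψ
    ⇒ˡ : ∀ {φ φ' ψ} → φ ▷₁ φ' → (φ ⇒ ψ) ▷₁ (φ' ⇒ ψ)
    ⇒ʳ : ∀ {φ ψ ψ'} → ψ ▷₁ ψ' → (φ ⇒ ψ) ▷₁ (φ ⇒ ψ')
    ∧ˡ : ∀ {φ φ' ψ} → φ ▷₁ φ' → (φ ∧' ψ) ▷₁ (φ' ∧' ψ)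
    ∧ʳ : ∀ {φ ψ ψ'} → ψ ▷₁ ψ' → (φ ∧' ψ) ▷₁ (φ ∧' ψ')
    ∨ˡ : ∀ {φ φ' ψ} → φ ▷₁ φ' → (φ ∨' ψ) ▷₁ (φ' ∨' ψ)
    ∨ʳ : ∀ {φ ψ ψ'} → ψ ▷₁ ψ' → (φ ∨' ψ) ▷₁ (φ ∨' ψ')
    ∀ᶜ : ∀ {x φ φ'} → φ ▷₁ φ' → ∀' x φ ▷₁ ∀' x φ'
    ∃ᶜ : ∀ {x φ φ'} → φ ▷₁ φ' → ∃' x φ ▷₁ ∃' x φ'

  _▷*_ : Formula L → Formula L → Set
  _▷*_ = Star _▷₁_

-- Say A ≼ B when every path of A is a subsequence of some path of B. A prenex step
-- φ ▷ ψ gives Alt φ ≼ Alt ψ: pulling out a quantifier with sign a prepends a to the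
-- paths it governs (unless they already start with a), and the paths of the other
-- operand are dominated by their own a-prefixed copies; renaming leaves Alt unchanged.
-- Domination is compatible with every connective, so it holds for ▷* as well.
-- Consequently deg φ ≤ deg ψ, and when the degrees coincide a path of φ of maximal
-- length is a subsequence of a path of ψ that is no longer, hence equal to it, and so
-- starts with the same sign.

module Submission where

open import Defs
open import Data.Bool using (Bool; true; false; T; not; _∧_; if_then_else_)
open import Data.Bool.Properties using (T-≡; T-not-≡)
open import Data.List using (List; []; _∷_; _++_; map; filterᵇ; foldr; length)
open import Data.List.Membership.Propositional using (_∈_)
open import Data.List.Membership.Propositional.Properties
  using ( ∈-++⁺ˡ; ∈-++⁺ʳ; ∈-++⁻; ∈-map⁺; ∈-map⁻; ∈-filter⁺; ∈-filter⁻
        ; ∈-map∘filter⁺; ∈-map∘filter⁻)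
open import Data.List.Relation.Binary.Equality.Propositional using (≋⇒≡)
open import Data.List.Relation.Binary.Sublist.Propositional using (_⊆_; []; _∷_; _∷ʳ_; ⊆-refl; ⊆-trans)
open import Data.List.Relation.Binary.Sublist.Propositional.Properties using (length-mono-≤; to-≋; map⁺)
open import Data.List.Relation.Unary.Any using (here; there)
open import Data.Maybe using (Maybe)
open import Data.Nat using (ℕ; zero; suc; _≤_; _<_; _⊔_; _≡ᵇ_; z≤n)
open import Data.Nat.Properties
  using (≤-trans; ≤-reflexive; ≤-antisym; ≤-<-trans; m≤m⊔n; m≤n⊔m; ⊔-lub; m≤n⇒m<n∨m≡n)
open import Data.Product using (_×_; _,_; proj₁; proj₂; ∃-syntax)
open import Data.Sum using (_⊎_; inj₁; inj₂; swap; map₂)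
open import Data.Unit using (tt)
open import Function using (id; _∘_; Equivalence)
open import Relation.Binary.Bundles using (Preorder)
open import Relation.Binary.PropositionalEquality
  using (_≡_; refl; sym; trans; cong; cong₂; isEquivalence) renaming (subst to ≡-subst)
open import Relation.Binary.Construct.Closure.ReflexiveTransitive using (ε; _◅_)
open import Relation.Nullary.Decidable using (T?)

private
  variable
    a : Sign
    s t : Path
    A A′ B B′ C : List Path

startsWith : Sign → Path → Bool
startsWith a s = isSign a (i s)

prefix : Sign → Path → Path
prefix a s = if startsWith a s then s else a ∷ s

⊆-prefix : ∀ a s → s ⊆ prefix a s
⊆-prefix a s with startsWith a s
... | true = ⊆-refl
... | false = a ∷ʳ ⊆-refl

prefix-⊆-∷ : ∀ a s → prefix a s ⊆ a ∷ s
prefix-⊆-∷ a s with startsWith a s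
... | true = a ∷ʳ ⊆-refl
... | false = ⊆-refl

∷-⊆-prefix-∷ : ∀ a b t → a ∷ t ⊆ prefix a (b ∷ t)
∷-⊆-prefix-∷ plus plus t = ⊆-refl
∷-⊆-prefix-∷ plus minus t = refl ∷ (minus ∷ʳ ⊆-refl)
∷-⊆-prefix-∷ minus plus t = refl ∷ (plus ∷ʳ ⊆-refl)
∷-⊆-prefix-∷ minus minus t = ⊆-refl

prefix-mono : ∀ a → s ⊆ t → prefix a s ⊆ prefix a t
prefix-mono a [] = ⊆-refl
prefix-mono {s} a (b ∷ʳ s⊆t) =
  ⊆-trans (prefix-⊆-∷ a s) (⊆-trans (refl ∷ s⊆t) (∷-⊆-prefix-∷ a b _))
prefix-mono {b ∷ s′} a (refl ∷ s⊆t) with startsWith a (b ∷ s′)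
... | true = refl ∷ s⊆t
... | false = refl ∷ (refl ∷ s⊆t)

prefix-⊥ : ∀ a s → prefix a s ⊥ₚ ≡ prefix (flip a) (s ⊥ₚ)
prefix-⊥ plus [] = refl
prefix-⊥ minus [] = refl
prefix-⊥ plus (plus ∷ s) = refl
prefix-⊥ plus (minus ∷ s) = refl
prefix-⊥ minus (plus ∷ s) = refl
prefix-⊥ minus (minus ∷ s) = refl

quantify : Sign → List Path → List Path
quantify a A = filterᵇ (startsWith a) A ++ map (a ∷_) (filterᵇ (not ∘ startsWith a) A)

prefix-absorbs : ∀ a s → T (startsWith a s) → prefix a s ≡ s
prefix-absorbs a s starts with startsWith a s
... | true = refl

prefix-conses : ∀ a s → T (not (startsWith a s)) → prefix a s ≡ a ∷ s
prefix-conses a s starts-not with startsWith a s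
... | false = refl

∈-quantify⁺ : ∀ a → t ∈ A → prefix a t ∈ quantify a A
∈-quantify⁺ {t} a t∈A with startsWith a t in eq
... | true = ∈-++⁺ˡ (∈-filter⁺ (T? ∘ startsWith a) t∈A (Equivalence.from T-≡ eq))
... | false = ∈-++⁺ʳ _ (∈-map∘filter⁺ (a ∷_) (T? ∘ not ∘ startsWith a)
                        (t , t∈A , refl , Equivalence.from T-not-≡ eq))

∈-quantify⁻ : ∀ a A → s ∈ quantify a A → ∃[ t ] t ∈ A × s ≡ prefix a t
∈-quantify⁻ {s} a A s∈ with ∈-++⁻ (filterᵇ (startsWith a) A) s∈
... | inj₁ s∈₁ =
  let s∈A , starts = ∈-filter⁻ (T? ∘ startsWith a) s∈₁ in s , s∈A , sym (prefix-absorbs a s starts)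
... | inj₂ s∈₂ with ∈-map∘filter⁻ (a ∷_) (T? ∘ not ∘ startsWith a) {xs = A} s∈₂
...   | t , t∈A , refl , starts-not = t , t∈A , sym (prefix-conses a t starts-not)

infix 4 _≼_ _≈_

record _≼_ (A B : List Path) : Set where
  constructor dominated
  field dominate : ∀ {s} → s ∈ A → ∃[ t ] t ∈ B × s ⊆ t

open _≼_

_≈_ : List Path → List Path → Set
A ≈ B = A ≼ B × B ≼ A

≼-reflexive : A ≡ B → A ≼ B
≼-reflexive refl = dominated λ s∈A → _ , s∈A , ⊆-refl

≼-trans : A ≼ B → B ≼ C → A ≼ C
≼-trans A≼B B≼C = dominated λ s∈A →
  let t , t∈B , s⊆t = dominate A≼B s∈A
      u , u∈C , t⊆u = dominate B≼C t∈B
  in  u , u∈C , ⊆-trans s⊆t t⊆u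

≼-preorder : Preorder _ _ _
≼-preorder = record
  { Carrier = List Path
  ; _≈_ = _≡_
  ; _≲_ = _≼_
  ; isPreorder = record
    { isEquivalence = isEquivalence ; reflexive = ≼-reflexive ; trans = ≼-trans }
  }

open import Relation.Binary.Reasoning.Preorder ≼-preorder
  using (begin_; step-≲; step-≡-⟩; step-≡-⟨; _∎)

≼-refl : A ≼ A
≼-refl = ≼-reflexive refl

∈⇒≼ : (∀ {s} → s ∈ A → s ∈ B) → A ≼ B
∈⇒≼ A⊆B = dominated λ s∈A → _ , A⊆B s∈A , ⊆-refl

++⁺-≼ : A ≼ A′ → B ≼ B′ → A ++ B ≼ A′ ++ B′
++⁺-≼ {A} {A′} {B} {B′} A≼A′ B≼B′ = dominated λ s∈ → case (∈-++⁻ A s∈)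
  where
  case : ∀ {s} → s ∈ A ⊎ s ∈ B → ∃[ t ] t ∈ A′ ++ B′ × s ⊆ t
  case (inj₁ s∈A) = let t , t∈ , s⊆t = dominate A≼A′ s∈A in t , ∈-++⁺ˡ t∈ , s⊆t
  case (inj₂ s∈B) = let t , t∈ , s⊆t = dominate B≼B′ s∈B in t , ∈-++⁺ʳ A′ t∈ , s⊆t

map-⊥-≼ : A ≼ B → map _⊥ₚ A ≼ map _⊥ₚ B
map-⊥-≼ {A} {B} A≼B = dominated λ s∈ → case (∈-map⁻ _⊥ₚ s∈)
  where
  case : ∀ {s} → ∃[ u ] u ∈ A × s ≡ u ⊥ₚ → ∃[ t ] t ∈ map _⊥ₚ B × s ⊆ t
  case (u , u∈A , refl) =
    let t , t∈B , u⊆t = dominate A≼B u∈A in t ⊥ₚ , ∈-map⁺ _⊥ₚ t∈B , map⁺ flip u⊆t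

quantify-≼ : ∀ a → A ≼ B → quantify a A ≼ quantify a B
quantify-≼ {A} {B} a A≼B = dominated λ s∈ → case (∈-quantify⁻ a A s∈)
  where
  case : ∀ {s} → ∃[ u ] u ∈ A × s ≡ prefix a u → ∃[ t ] t ∈ quantify a B × s ⊆ t
  case (u , u∈A , refl) =
    let t , t∈B , u⊆t = dominate A≼B u∈A in prefix a t , ∈-quantify⁺ a t∈B , prefix-mono a u⊆t

≼-quantify : ∀ a A → A ≼ quantify a A
≼-quantify a A = dominated λ {s} s∈A → prefix a s , ∈-quantify⁺ a s∈A , ⊆-prefix a s

quantify-++ : ∀ a A B → quantify a A ++ quantify a B ≼ quantify a (A ++ B)
quantify-++ a A B = ∈⇒≼ λ s∈ → case (∈-++⁻ (quantify a A) s∈)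
  where
  case : ∀ {s} → s ∈ quantify a A ⊎ s ∈ quantify a B → s ∈ quantify a (A ++ B)
  case (inj₁ s∈) with ∈-quantify⁻ a A s∈
  ... | t , t∈A , refl = ∈-quantify⁺ a (∈-++⁺ˡ t∈A)
  case (inj₂ s∈) with ∈-quantify⁻ a B s∈
  ... | t , t∈B , refl = ∈-quantify⁺ a (∈-++⁺ʳ A t∈B)

quantify-pullˡ : ∀ a A B → quantify a A ++ B ≼ quantify a (A ++ B)
quantify-pullˡ a A B = begin
  quantify a A ++ B             ≲⟨ ++⁺-≼ (≼-refl {quantify a A}) (≼-quantify a B) ⟩
  quantify a A ++ quantify a B  ≲⟨ quantify-++ a A B ⟩
  quantify a (A ++ B)           ∎

quantify-pullʳ : ∀ a A B → A ++ quantify a B ≼ quantify a (A ++ B)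
quantify-pullʳ a A B = begin
  A ++ quantify a B             ≲⟨ ++⁺-≼ (≼-quantify a A) (≼-refl {quantify a B}) ⟩
  quantify a A ++ quantify a B  ≲⟨ quantify-++ a A B ⟩
  quantify a (A ++ B)           ∎

map-⊥-quantify : ∀ a A → map _⊥ₚ (quantify a A) ≼ quantify (flip a) (map _⊥ₚ A)
map-⊥-quantify a A = ∈⇒≼ λ s∈ → case (∈-map⁻ _⊥ₚ s∈)
  where
  case : ∀ {s} → ∃[ u ] u ∈ quantify a A × s ≡ u ⊥ₚ → s ∈ quantify (flip a) (map _⊥ₚ A)
  case (u , u∈ , refl) with ∈-quantify⁻ a A u∈
  ... | t , t∈A , refl rewrite prefix-⊥ a t = ∈-quantify⁺ (flip a) (∈-map⁺ _⊥ₚ t∈A)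

height : List Path → ℕ
height A = foldr _⊔_ 0 (map length A)

length≤height : ∀ A → s ∈ A → length s ≤ height A
length≤height (t ∷ A) (here refl) = m≤m⊔n (length t) (height A)
length≤height (t ∷ A) (there s∈A) = ≤-trans (length≤height A s∈A) (m≤n⊔m (length t) (height A))

height-lub : ∀ A {n} → (∀ {s} → s ∈ A → length s ≤ n) → height A ≤ n
height-lub [] _ = z≤n
height-lub (t ∷ A) bound = ⊔-lub (bound (here refl)) (height-lub A (bound ∘ there))

height-mono : A ≼ B → height A ≤ height B
height-mono {A} {B} A≼B = height-lub A λ s∈A →
  let t , t∈B , s⊆t = dominate A≼B s∈A in ≤-trans (length-mono-≤ s⊆t) (length≤height B t∈B)

≼⇒height<⊎≡ : ∀ {n} → A ≼ B → height B ≡ n → height A < n ⊎ height A ≡ n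
≼⇒height<⊎≡ A≼B refl = m≤n⇒m<n∨m≡n (height-mono A≼B)

InitialAt : Maybe Sign → ℕ → List Path → Set
InitialAt c n A = ∀ s → s ∈ A → length s ≡ n → i s ≡ c

InitialAt-≼ : ∀ {c n} → A ≼ B → height B ≤ n → InitialAt c n B → InitialAt c n A
InitialAt-≼ {B = B} A≼B B≤n initial s s∈A refl with dominate A≼B s∈A
... | t , t∈B , s⊆t = ≡-subst (λ u → i u ≡ _) (sym s≡t) (initial t t∈B (sym |s|≡|t|))
  where
  |s|≡|t| : length s ≡ length t
  |s|≡|t| = ≤-antisym (length-mono-≤ s⊆t) (≤-trans (length≤height B t∈B) B≤n)
  s≡t : s ≡ t
  s≡t = ≋⇒≡ (to-≋ |s|≡|t| s⊆t)

[]-≈-[][] : [] ∷ [] ≈ [] ∷ [] ∷ []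
[]-≈-[][] = ∈⇒≼ (λ { (here refl) → here refl })
          , ∈⇒≼ (λ { (here refl) → here refl ; (there (here refl)) → here refl })

-- The quantifier-free clause of Alt for a binary connective gives ⟨⟩ once, the general
-- clause would give it twice; up to ≈ this makes no difference.
qf-guard-≈ : ∀ b c B → (T b → T c → B ≡ [] ∷ [] ∷ []) → (if b ∧ c then [] ∷ [] else B) ≈ B
qf-guard-≈ true true B h rewrite h tt tt = []-≈-[][]
qf-guard-≈ true false B h = ≼-refl , ≼-refl
qf-guard-≈ false c B h = ≼-refl , ≼-refl

module _ {L : Signature} where

  Alt-qf : ∀ (φ : Formula L) → T (qf φ) → Alt φ ≡ [] ∷ []
  Alt-qf (atom R ts) _ = refl
  Alt-qf ⊥' _ = refl
  Alt-qf (φ ⇒ ψ) h rewrite Equivalence.to T-≡ h = refl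
  Alt-qf (φ ∧' ψ) h rewrite Equivalence.to T-≡ h = refl
  Alt-qf (φ ∨' ψ) h rewrite Equivalence.to T-≡ h = refl

  Decomposes : (List Path → List Path) → (Formula L → Formula L → Formula L) → Set
  Decomposes f _∙_ = ∀ φ ψ → Alt (φ ∙ ψ) ≈ f (Alt φ) ++ Alt ψ

  Alt-⇒ : Decomposes (map _⊥ₚ) _⇒_
  Alt-⇒ φ ψ = qf-guard-≈ (qf φ) (qf ψ) _ λ qf-φ qf-ψ →
    cong₂ _++_ (cong (map _⊥ₚ) (Alt-qf φ qf-φ)) (Alt-qf ψ qf-ψ)

  Alt-∧ : Decomposes id _∧'_
  Alt-∧ φ ψ = qf-guard-≈ (qf φ) (qf ψ) _ λ qf-φ qf-ψ → cong₂ _++_ (Alt-qf φ qf-φ) (Alt-qf ψ qf-ψ)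

  Alt-∨ : Decomposes id _∨'_
  Alt-∨ φ ψ = qf-guard-≈ (qf φ) (qf ψ) _ λ qf-φ qf-ψ → cong₂ _++_ (Alt-qf φ qf-φ) (Alt-qf ψ qf-ψ)

  sign : Quant {L} → Sign
  sign ∀Q = minus
  sign ∃Q = plus

  dual : Quant {L} → Quant {L}
  dual ∀Q = ∃Q
  dual ∃Q = ∀Q

  Alt-Q : ∀ Q x (φ : Formula L) → Alt (Q[ Q ] x φ) ≡ quantify (sign Q) (Alt φ)
  Alt-Q ∀Q x φ = refl
  Alt-Q ∃Q x φ = refl

  Alt-dual : ∀ Q x (φ : Formula L) → Alt (Q[ dual Q ] x φ) ≡ quantify (flip (sign Q)) (Alt φ)
  Alt-dual ∀Q x φ = refl
  Alt-dual ∃Q x φ = refl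

  qf-subst : ∀ x y (φ : Formula L) → qf (subst x y φ) ≡ qf φ
  qf-subst x y (atom R ts) = refl
  qf-subst x y ⊥' = refl
  qf-subst x y (φ ⇒ ψ) = cong₂ _∧_ (qf-subst x y φ) (qf-subst x y ψ)
  qf-subst x y (φ ∧' ψ) = cong₂ _∧_ (qf-subst x y φ) (qf-subst x y ψ)
  qf-subst x y (φ ∨' ψ) = cong₂ _∧_ (qf-subst x y φ) (qf-subst x y ψ)
  qf-subst x y (∀' z φ) with z ≡ᵇ x
  ... | true = refl
  ... | false = refl
  qf-subst x y (∃' z φ) with z ≡ᵇ x
  ... | true = refl
  ... | false = refl

  Alt-subst : ∀ x y (φ : Formula L) → Alt (subst x y φ) ≡ Alt φ
  Alt-subst x y (atom R ts) = refl
  Alt-subst x y ⊥' = refl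
  Alt-subst x y (φ ⇒ ψ)
    rewrite qf-subst x y φ | qf-subst x y ψ | Alt-subst x y φ | Alt-subst x y ψ = refl
  Alt-subst x y (φ ∧' ψ)
    rewrite qf-subst x y φ | qf-subst x y ψ | Alt-subst x y φ | Alt-subst x y ψ = refl
  Alt-subst x y (φ ∨' ψ)
    rewrite qf-subst x y φ | qf-subst x y ψ | Alt-subst x y φ | Alt-subst x y ψ = refl
  Alt-subst x y (∀' z φ) with z ≡ᵇ x
  ... | true = refl
  ... | false = cong (quantify minus) (Alt-subst x y φ)
  Alt-subst x y (∃' z φ) with z ≡ᵇ x
  ... | true = refl
  ... | false = cong (quantify plus) (Alt-subst x y φ)

  module _ (f : List Path → List Path) (f-mono : ∀ {A B} → A ≼ B → f A ≼ f B)
           (_∙_ : Formula L → Formula L → Formula L) (decomposes : Decomposes f _∙_) where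

    pullʳ-≼ : ∀ Q x ξ δ → Alt (δ ∙ Q[ Q ] x ξ) ≼ Alt (Q[ Q ] x (δ ∙ ξ))
    pullʳ-≼ Q x ξ δ = begin
      Alt (δ ∙ Q[ Q ] x ξ)                    ≲⟨ proj₁ (decomposes δ (Q[ Q ] x ξ)) ⟩
      f (Alt δ) ++ Alt (Q[ Q ] x ξ)           ≡⟨ cong (f (Alt δ) ++_) (Alt-Q Q x ξ) ⟩
      f (Alt δ) ++ quantify (sign Q) (Alt ξ)  ≲⟨ quantify-pullʳ (sign Q) (f (Alt δ)) (Alt ξ) ⟩
      quantify (sign Q) (f (Alt δ) ++ Alt ξ)  ≲⟨ quantify-≼ (sign Q) (proj₂ (decomposes δ ξ)) ⟩
      quantify (sign Q) (Alt (δ ∙ ξ))         ≡⟨ Alt-Q Q x (δ ∙ ξ) ⟨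
      Alt (Q[ Q ] x (δ ∙ ξ))                  ∎

    congˡ-≼ : ∀ φ φ′ ψ → Alt φ ≼ Alt φ′ → Alt (φ ∙ ψ) ≼ Alt (φ′ ∙ ψ)
    congˡ-≼ φ φ′ ψ φ≼φ′ = begin
      Alt (φ ∙ ψ)           ≲⟨ proj₁ (decomposes φ ψ) ⟩
      f (Alt φ) ++ Alt ψ    ≲⟨ ++⁺-≼ (f-mono φ≼φ′) ≼-refl ⟩
      f (Alt φ′) ++ Alt ψ   ≲⟨ proj₂ (decomposes φ′ ψ) ⟩
      Alt (φ′ ∙ ψ)          ∎

    congʳ-≼ : ∀ φ ψ ψ′ → Alt ψ ≼ Alt ψ′ → Alt (φ ∙ ψ) ≼ Alt (φ ∙ ψ′)
    congʳ-≼ φ ψ ψ′ ψ≼ψ′ = begin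
      Alt (φ ∙ ψ)           ≲⟨ proj₁ (decomposes φ ψ) ⟩
      f (Alt φ) ++ Alt ψ    ≲⟨ ++⁺-≼ ≼-refl ψ≼ψ′ ⟩
      f (Alt φ) ++ Alt ψ′   ≲⟨ proj₂ (decomposes φ ψ′) ⟩
      Alt (φ ∙ ψ′)          ∎

  pullˡ-≼ : ∀ _∙_ → Decomposes id _∙_ →
            ∀ Q x ξ δ → Alt (Q[ Q ] x ξ ∙ δ) ≼ Alt (Q[ Q ] x (ξ ∙ δ))
  pullˡ-≼ _∙_ decomposes Q x ξ δ = begin
    Alt (Q[ Q ] x ξ ∙ δ)                ≲⟨ proj₁ (decomposes (Q[ Q ] x ξ) δ) ⟩
    Alt (Q[ Q ] x ξ) ++ Alt δ           ≡⟨ cong (_++ Alt δ) (Alt-Q Q x ξ) ⟩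
    quantify (sign Q) (Alt ξ) ++ Alt δ  ≲⟨ quantify-pullˡ (sign Q) (Alt ξ) (Alt δ) ⟩
    quantify (sign Q) (Alt ξ ++ Alt δ)  ≲⟨ quantify-≼ (sign Q) (proj₂ (decomposes ξ δ)) ⟩
    quantify (sign Q) (Alt (ξ ∙ δ))     ≡⟨ Alt-Q Q x (ξ ∙ δ) ⟨
    Alt (Q[ Q ] x (ξ ∙ δ))              ∎

  pull-⇒ˡ-≼ : ∀ Q x ξ δ → Alt (Q[ Q ] x ξ ⇒ δ) ≼ Alt (Q[ dual Q ] x (ξ ⇒ δ))
  pull-⇒ˡ-≼ Q x ξ δ = begin
    Alt (Q[ Q ] x ξ ⇒ δ)
      ≲⟨ proj₁ (Alt-⇒ (Q[ Q ] x ξ) δ) ⟩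
    map _⊥ₚ (Alt (Q[ Q ] x ξ)) ++ Alt δ
      ≡⟨ cong (λ A → map _⊥ₚ A ++ Alt δ) (Alt-Q Q x ξ) ⟩
    map _⊥ₚ (quantify (sign Q) (Alt ξ)) ++ Alt δ
      ≲⟨ ++⁺-≼ (map-⊥-quantify (sign Q) (Alt ξ)) ≼-refl ⟩
    quantify (flip (sign Q)) (map _⊥ₚ (Alt ξ)) ++ Alt δ
      ≲⟨ quantify-pullˡ (flip (sign Q)) (map _⊥ₚ (Alt ξ)) (Alt δ) ⟩
    quantify (flip (sign Q)) (map _⊥ₚ (Alt ξ) ++ Alt δ)
      ≲⟨ quantify-≼ (flip (sign Q)) (proj₂ (Alt-⇒ ξ δ)) ⟩
    quantify (flip (sign Q)) (Alt (ξ ⇒ δ))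
      ≡⟨ Alt-dual Q x (ξ ⇒ δ) ⟨
    Alt (Q[ dual Q ] x (ξ ⇒ δ))
      ∎

  rename-Alt : ∀ Q x y (ξ : Formula L) → Alt (Q[ Q ] x ξ) ≡ Alt (Q[ Q ] y (subst x y ξ))
  rename-Alt Q x y ξ = trans (Alt-Q Q x ξ)
    (trans (cong (quantify (sign Q)) (sym (Alt-subst x y ξ))) (sym (Alt-Q Q y (subst x y ξ))))

  ▷⇒≼ : ∀ {φ ψ : Formula L} → φ ▷ ψ → Alt φ ≼ Alt ψ
  ▷⇒≼ (∃⇒ {x} {ξ} {δ} _) = pull-⇒ˡ-≼ ∃Q x ξ δ
  ▷⇒≼ (∀⇒ {x} {ξ} {δ} _) = pull-⇒ˡ-≼ ∀Q x ξ δ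
  ▷⇒≼ (⇒Q {Q} {x} {ξ} {δ} _) = pullʳ-≼ (map _⊥ₚ) map-⊥-≼ _⇒_ Alt-⇒ Q x ξ δ
  ▷⇒≼ (Q∧ {Q} {x} {ξ} {δ} _) = pullˡ-≼ _∧'_ Alt-∧ Q x ξ δ
  ▷⇒≼ (∧Q {Q} {x} {ξ} {δ} _) = pullʳ-≼ id id _∧'_ Alt-∧ Q x ξ δ
  ▷⇒≼ (Q∨ {Q} {x} {ξ} {δ} _) = pullˡ-≼ _∨'_ Alt-∨ Q x ξ δ
  ▷⇒≼ (∨Q {Q} {x} {ξ} {δ} _) = pullʳ-≼ id id _∨'_ Alt-∨ Q x ξ δ
  ▷⇒≼ (ren {Q} {x} {y} {ξ} _) = ≼-reflexive (rename-Alt Q x y ξ)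

  ▷₁⇒≼ : ∀ {φ ψ : Formula L} → φ ▷₁ ψ → Alt φ ≼ Alt ψ
  ▷₁⇒≼ (here r) = ▷⇒≼ r
  ▷₁⇒≼ (⇒ˡ {φ} {φ′} {ψ} r) = congˡ-≼ (map _⊥ₚ) map-⊥-≼ _⇒_ Alt-⇒ φ φ′ ψ (▷₁⇒≼ r)
  ▷₁⇒≼ (⇒ʳ {φ} {ψ} {ψ′} r) = congʳ-≼ (map _⊥ₚ) map-⊥-≼ _⇒_ Alt-⇒ φ ψ ψ′ (▷₁⇒≼ r)
  ▷₁⇒≼ (∧ˡ {φ} {φ′} {ψ} r) = congˡ-≼ id id _∧'_ Alt-∧ φ φ′ ψ (▷₁⇒≼ r)
  ▷₁⇒≼ (∧ʳ {φ} {ψ} {ψ′} r) = congʳ-≼ id id _∧'_ Alt-∧ φ ψ ψ′ (▷₁⇒≼ r)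
  ▷₁⇒≼ (∨ˡ {φ} {φ′} {ψ} r) = congˡ-≼ id id _∨'_ Alt-∨ φ φ′ ψ (▷₁⇒≼ r)
  ▷₁⇒≼ (∨ʳ {φ} {ψ} {ψ′} r) = congʳ-≼ id id _∨'_ Alt-∨ φ ψ ψ′ (▷₁⇒≼ r)
  ▷₁⇒≼ (∀ᶜ r) = quantify-≼ minus (▷₁⇒≼ r)
  ▷₁⇒≼ (∃ᶜ r) = quantify-≼ plus (▷₁⇒≼ r)

  ▷*⇒≼ : ∀ {φ ψ : Formula L} → φ ▷* ψ → Alt φ ≼ Alt ψ
  ▷*⇒≼ ε = ≼-refl
  ▷*⇒≼ (r ◅ rs) = ≼-trans (▷₁⇒≼ r) (▷*⇒≼ rs)

  E⁺-antitone : ∀ {φ ψ : Formula L} k → Alt φ ≼ Alt ψ → E⁺ k ψ → E⁺ k φ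
  E⁺-antitone k φ≼ψ (inj₂ ψ<k) = inj₂ (≤-<-trans (height-mono φ≼ψ) ψ<k)
  E⁺-antitone zero φ≼ψ (inj₁ ψ∈F) = swap (≼⇒height<⊎≡ φ≼ψ ψ∈F)
  E⁺-antitone (suc k) φ≼ψ (inj₁ (ψ∈F , initial)) =
    swap (map₂ (_, InitialAt-≼ φ≼ψ (≤-reflexive ψ∈F) initial) (≼⇒height<⊎≡ φ≼ψ ψ∈F))

  U⁺-antitone : ∀ {φ ψ : Formula L} k → Alt φ ≼ Alt ψ → U⁺ k ψ → U⁺ k φ
  U⁺-antitone k φ≼ψ (inj₂ ψ<k) = inj₂ (≤-<-trans (height-mono φ≼ψ) ψ<k)
  U⁺-antitone zero φ≼ψ (inj₁ ψ∈F) = swap (≼⇒height<⊎≡ φ≼ψ ψ∈F)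
  U⁺-antitone (suc k) φ≼ψ (inj₁ (ψ∈F , initial)) =
    swap (map₂ (_, InitialAt-≼ φ≼ψ (≤-reflexive ψ∈F) initial) (≼⇒height<⊎≡ φ≼ψ ψ∈F))

lemma4p6 : (L : Signature) (k : ℕ) (φ ψ : Formula L) → φ ▷* ψ →
    (E⁺ k ψ → E⁺ k φ) × (U⁺ k ψ → U⁺ k φ)
lemma4p6 L k φ ψ φ▷*ψ = E⁺-antitone k (▷*⇒≼ φ▷*ψ) , U⁺-antitone k (▷*⇒≼ φ▷*ψ)
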